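{- For every positive integer $n$ and every function $f:\{0,1\}^n\to\{0,1\}$, there exist finitely many prime clocks $[q_1,t_1],\dots,[q_L,t_L]$ such that the finite prime clock sum $S=[q_1,t_1]\oplus\cdots\oplus[q_L,t_L]\in\Omega_2$ computes $f$, i.e. for every $x=x_1x_2\cdots x_n\in\{0,1\}^n$ we have $S(m_x)=f(x)$, where $m_x=\sum_{i=1}^n x_i2^{n-i}\in\{0,\dots,2^n-1\}$.
   Context: $\mathbb{N}=\{0,1,2,\dots\}$. For a prime $p$ and integer $0\le t\le p-1$, the prime clock $[p,t]:\mathbb{N}\to\mathbb{N}$ is $[p,t](m)=(m+t)\bmod p$. $\Omega_2$ is the set of functions $\mathbb{N}\to\{0,1\}$, and the finite prime clock sum $[q_1,t_1]\oplus\cdots\oplus[q_L,t_L]\in\Omega_2$ is the function $m\mapsto\big(\sum_{i=1}^L[q_i,t_i](m)\big)\bmod 2$ (addition computed in $\mathbb{Z}$). Computing $f$ means that the first $2^n$ values $S(0),\dots,S(2^n-1)$ form the truth table of $f$, with $\{0,1\}^n$ listed in increasing binary (lexicographic) order. -}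

module Defs where

open import Data.Nat using (ℕ; zero; suc; _+_; _*_; _^_; _<_; NonZero)
open import Data.Nat.DivMod using (_%_)
open import Data.Nat.Primality using (Prime)
open import Data.Bool using (Bool; true; false)
open import Data.Vec using (Vec; []; _∷_)
open import Data.List using (List; []; _∷_)
open import Data.Product using (Σ; _×_)
open import Relation.Binary.PropositionalEquality using (_≡_)

record PrimeClock : Set where
  constructor [_,_]⟨_,_⟩
  field
    p      : ℕ
    t      : ℕ
    prime  : Prime p
    t<p    : t < p

open PrimeClock public

prime⇒nonZero : ∀ {p} → Prime p → NonZero p
prime⇒nonZero {suc p} _ = record { nonZero = _ }

evalClock : PrimeClock → ℕ → ℕ
evalClock c m = _%_ (m + t c) (p c) {{prime⇒nonZero (prime c)}}

clockSum : List PrimeClock → ℕ → ℕ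
clockSum []       m = 0
clockSum (c ∷ cs) m = evalClock c m + clockSum cs m

⊕Sum : List PrimeClock → ℕ → ℕ
⊕Sum cs m = clockSum cs m % 2

bit : Bool → ℕ
bit false = 0
bit true  = 1

binVal : ∀ {n} → Vec Bool n → ℕ
binVal {zero}  []       = 0
binVal {suc n} (b ∷ xs) = bit b * 2 ^ n + binVal xs

Computes : ∀ n → (ℕ → ℕ) → (Vec Bool n → Bool) → Set
Computes n S f = ∀ (x : Vec Bool n) → S (binVal x) ≡ bit (f x)

-- A 0/1 pattern on [0, N) is produced by induction on N: when the sum built so far is
-- wrong at N, append clocks whose sum is even below N and odd at N.  For a prime
-- p > N + 1 the clocks [p, p − N] and [p, p − N − 1] read m + p − N and m + p − N − 1
-- for m < N (an odd total) but 0 and p − 1 at N (an even total); together with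
-- [2,0] ⊕ [2,1], which is constantly 1, and since p is odd, this is the required pulse.
-- A truth table is such a pattern on [0, 2ⁿ), read through binary expansion.
module Submission where

open import Defs
open import Data.Nat using (ℕ; zero; suc; _+_; _*_; _∸_; _^_; _≟_; _≤_; _<_; z≤n; s≤s; z<s; NonZero; _≤?_; _!)
open import Data.Nat.Properties
open import Data.Nat.DivMod using (_%_; m<n⇒m%n≡m; n%n≡0; m%n%n≡m%n; m*n%n≡0; %-distribˡ-+; m%n<n)
open import Data.Nat.Divisibility using (_∣_; divides; ∣-trans; ∣m+n∣m⇒∣n; ∣1⇒≡1; m∣m*n; m≤n⇒m!∣n!; m%n≡0⇒n∣m)
open import Data.Nat.Divisibility.Core using (hasNonTrivialDivisor)
open import Data.Nat.Primality using (Prime; prime[2]; ¬prime[1])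
open import Data.Nat.Primality.Factorisation using (factorise)
open import Data.Nat.Tactic.RingSolver using (solve-∀)
open import Data.Bool using (Bool; true; false)
open import Data.Vec using (Vec; []; _∷_)
open import Data.List using (List; []; _∷_; _++_)
open import Data.List.Relation.Unary.All using (_∷_)
open import Data.Product using (Σ; ∃-syntax; _×_; _,_)
open import Data.Sum using ([_,_]′)
open import Function using (_∘_)
open import Relation.Nullary using (¬_; yes; no; contradiction)
open import Relation.Binary.PropositionalEquality

m≤n⇒m∣n! : ∀ {m n} .{{_ : NonZero m}} → m ≤ n → m ∣ n !
m≤n⇒m∣n! {suc m} m≤n = ∣-trans (divides (m !) (*-comm (suc m) (m !))) (m≤n⇒m!∣n! m≤n)

∃prime∣ : ∀ {n} → 1 < n → ∃[ p ] Prime p × p ∣ n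
∃prime∣ {n@(suc _)} 1<n with factorise n
... | record { factors = [] ; isFactorisation = n≡1 } = contradiction n≡1 (>⇒≢ 1<n)
... | record { factors = p ∷ _ ; isFactorisation = n≡p*ps ; factorsPrime = p-prime ∷ _ } =
  p , p-prime , subst (p ∣_) (sym n≡p*ps) (m∣m*n _)

∃prime> : ∀ n → ∃[ p ] Prime p × n < p
∃prime> n with ∃prime∣ (s≤s (1≤n! n))
... | p , p-prime , p∣1+n! = p , p-prime , ≰⇒> p≰n
  where
  instance
    _ : NonZero p
    _ = prime⇒nonZero p-prime

  p≰n : ¬ p ≤ n
  p≰n p≤n = ¬prime[1] (subst Prime p≡1 p-prime)
    where
    p≡1 : p ≡ 1
    p≡1 = ∣1⇒≡1 (∣m+n∣m⇒∣n (subst (p ∣_) (+-comm 1 (n !)) p∣1+n!) (m≤n⇒m∣n! p≤n))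

prime>2⇒odd : ∀ {p} → Prime p → 2 < p → p % 2 ≡ 1
prime>2⇒odd {p} p-prime 2<p with p % 2 in p%2≡r | m%n<n p 2
... | 0 | _ = contradiction (hasNonTrivialDivisor 2<p (m%n≡0⇒n∣m p 2 p%2≡r)) (Prime.notComposite p-prime)
... | 1 | _ = refl
... | suc (suc _) | s≤s (s≤s ())

evalClock-< : ∀ c {m} → m + t c < p c → evalClock c m ≡ m + t c
evalClock-< c = m<n⇒m%n≡m {{prime⇒nonZero (prime c)}}

evalClock-≡ : ∀ c {m} → m + t c ≡ p c → evalClock c m ≡ 0
evalClock-≡ [ _ , _ ]⟨ q-prime , _ ⟩ refl = n%n≡0 _ {{prime⇒nonZero q-prime}}

clockSum-++ : ∀ xs ys m → clockSum (xs ++ ys) m ≡ clockSum xs m + clockSum ys m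
clockSum-++ []       ys m = refl
clockSum-++ (x ∷ xs) ys m =
  trans (cong (evalClock x m +_) (clockSum-++ xs ys m)) (sym (+-assoc (evalClock x m) _ _))

⊕Sum-++ : ∀ xs ys m → ⊕Sum (xs ++ ys) m ≡ (⊕Sum xs m + ⊕Sum ys m) % 2
⊕Sum-++ xs ys m = trans (cong (_% 2) (clockSum-++ xs ys m)) (%-distribˡ-+ (clockSum xs m) _ 2)

m%2+[m+1]%2≡1 : ∀ m → m % 2 + (m + 1) % 2 ≡ 1
m%2+[m+1]%2≡1 m with m % 2 | %-distribˡ-+ m 1 2 | m%n<n m 2
... | 0           | [m+1]%2≡1 | _ = [m+1]%2≡1
... | 1           | [m+1]%2≡0 | _ = cong suc [m+1]%2≡0
... | suc (suc _) | _         | s≤s (s≤s ())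

[2,0] [2,1] : PrimeClock
[2,0] = [ 2 , 0 ]⟨ prime[2] , s≤s z≤n ⟩
[2,1] = [ 2 , 1 ]⟨ prime[2] , s≤s (s≤s z≤n) ⟩

clockSum-[2,0][2,1] : ∀ m → clockSum ([2,0] ∷ [2,1] ∷ []) m ≡ 1
clockSum-[2,0][2,1] m = begin
  (m + 0) % 2 + ((m + 1) % 2 + 0) ≡⟨ cong₂ (λ a b → a % 2 + b) (+-identityʳ m) (+-identityʳ _) ⟩
  m % 2 + (m + 1) % 2             ≡⟨ m%2+[m+1]%2≡1 m ⟩
  1                               ∎
  where open ≡-Reasoning

PulseAt : ℕ → List PrimeClock → Set
PulseAt k ds = (∀ m → m < k → ⊕Sum ds m ≡ 0) × ⊕Sum ds k ≡ 1

module OddPrimePulse {k b p} (p-prime : Prime p) (p-odd : p % 2 ≡ 1)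
                     (k+1+b≡p : k + suc b ≡ p) (0<k : 0 < k) where

  upper lower : PrimeClock
  upper = [ p , suc b ]⟨ p-prime , 1+b<p ⟩
    where
    1+b<p : suc b < p
    1+b<p = subst (suc b <_) k+1+b≡p (m<n+m (suc b) 0<k)
  lower = [ p , b ]⟨ p-prime , <-trans (n<1+n b) (t<p upper) ⟩

  clocks : List PrimeClock
  clocks = upper ∷ lower ∷ [2,0] ∷ [2,1] ∷ []

  clockSum-clocks : ∀ m → clockSum clocks m ≡ evalClock upper m + (evalClock lower m + 1)
  clockSum-clocks m = cong (λ s → evalClock upper m + (evalClock lower m + s)) (clockSum-[2,0][2,1] m)

  even-below : ∀ m → m < k → ⊕Sum clocks m ≡ 0
  even-below m m<k = begin
    clockSum clocks m % 2                   ≡⟨ cong (_% 2) (trans (clockSum-clocks m) values) ⟩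
    ((m + suc b) + ((m + b) + 1)) % 2       ≡⟨ cong (_% 2) (double m b) ⟩
    (suc (m + b) * 2) % 2                   ≡⟨ m*n%n≡0 (suc (m + b)) 2 ⟩
    0                                       ∎
    where
    open ≡-Reasoning
    m+1+b<p : m + suc b < p
    m+1+b<p = subst (m + suc b <_) k+1+b≡p (+-monoˡ-< (suc b) m<k)

    double : ∀ m b → (m + suc b) + ((m + b) + 1) ≡ suc (m + b) * 2
    double = solve-∀

    values : evalClock upper m + (evalClock lower m + 1) ≡ (m + suc b) + ((m + b) + 1)
    values = cong₂ (λ x y → x + (y + 1))
      (evalClock-< upper m+1+b<p)
      (evalClock-< lower (≤-<-trans (+-monoʳ-≤ m (n≤1+n b)) m+1+b<p))

  odd-at : ⊕Sum clocks k ≡ 1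
  odd-at = begin
    clockSum clocks k % 2                    ≡⟨ cong (_% 2) (clockSum-clocks k) ⟩
    (evalClock upper k + (evalClock lower k + 1)) % 2
      ≡⟨ cong₂ (λ x y → (x + (y + 1)) % 2) (evalClock-≡ upper k+1+b≡p) (evalClock-< lower k+b<p) ⟩
    ((k + b) + 1) % 2                        ≡⟨ cong (_% 2) (trans (+-comm (k + b) 1) (sym (+-suc k b))) ⟩
    (k + suc b) % 2                          ≡⟨ cong (_% 2) k+1+b≡p ⟩
    p % 2                                    ≡⟨ p-odd ⟩
    1                                        ∎
    where
    open ≡-Reasoning
    k+b<p : k + b < p
    k+b<p = subst (k + b <_) k+1+b≡p (+-monoʳ-< k (n<1+n b))

  pulse : PulseAt k clocks
  pulse = even-below , odd-at

∃pulse : ∀ k → ∃[ ds ] PulseAt k ds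
∃pulse zero = [2,1] ∷ [] , (λ _ ()) , refl
∃pulse k@(suc _) with ∃prime> (suc k)
... | p , p-prime , 1+k<p with m≤n⇒∃[o]m+o≡n (<⇒≤ 1+k<p)
...   | b , 1+k+b≡p = OddPrimePulse.clocks p-prime p-odd k+1+b≡p z<s
                    , OddPrimePulse.pulse p-prime p-odd k+1+b≡p z<s
  where
  p-odd : p % 2 ≡ 1
  p-odd = prime>2⇒odd p-prime (≤-<-trans (s≤s (s≤s z≤n)) 1+k<p)
  k+1+b≡p : k + suc b ≡ p
  k+1+b≡p = trans (+-suc k b) 1+k+b≡p

<-suc-intro : ∀ {P : ℕ → Set} {N} → (∀ m → m < N → P m) → P N → ∀ m → m < suc N → P m
<-suc-intro below at m m<1+N = [ below m , (λ { refl → at }) ]′ (m<1+n⇒m<n∨m≡n m<1+N)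

[1+s]%2≡bit : ∀ s b → s < 2 → s ≢ bit b → (1 + s) % 2 ≡ bit b
[1+s]%2≡bit 0 false _ 0≢0 = contradiction refl 0≢0
[1+s]%2≡bit 0 true  _ _   = refl
[1+s]%2≡bit 1 false _ _   = refl
[1+s]%2≡bit 1 true  _ 1≢1 = contradiction refl 1≢1
[1+s]%2≡bit (suc (suc _)) _ (s≤s (s≤s ())) _

interpolate : ∀ N (g : ℕ → Bool) → ∃[ cs ] (∀ m → m < N → ⊕Sum cs m ≡ bit (g m))
interpolate zero    g = [] , λ _ ()
interpolate (suc N) g with interpolate N g
... | cs , agree with ⊕Sum cs N ≟ bit (g N)
...   | yes agreeN    = cs , <-suc-intro agree agreeN
...   | no disagreeN with ∃pulse N
...     | ds , zero-below , one-at = ds ++ cs , <-suc-intro agree′ agreeN′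
  where
  open ≡-Reasoning

  agree′ : ∀ m → m < N → ⊕Sum (ds ++ cs) m ≡ bit (g m)
  agree′ m m<N = begin
    ⊕Sum (ds ++ cs) m            ≡⟨ ⊕Sum-++ ds cs m ⟩
    (⊕Sum ds m + ⊕Sum cs m) % 2  ≡⟨ cong (λ s → (s + ⊕Sum cs m) % 2) (zero-below m m<N) ⟩
    ⊕Sum cs m % 2                ≡⟨ m%n%n≡m%n (clockSum cs m) 2 ⟩
    ⊕Sum cs m                    ≡⟨ agree m m<N ⟩
    bit (g m)                    ∎

  agreeN′ : ⊕Sum (ds ++ cs) N ≡ bit (g N)
  agreeN′ = begin
    ⊕Sum (ds ++ cs) N            ≡⟨ ⊕Sum-++ ds cs N ⟩
    (⊕Sum ds N + ⊕Sum cs N) % 2  ≡⟨ cong (λ s → (s + ⊕Sum cs N) % 2) one-at ⟩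
    (1 + ⊕Sum cs N) % 2          ≡⟨ [1+s]%2≡bit _ (g N) (m%n<n (clockSum cs N) 2) disagreeN ⟩
    bit (g N)                    ∎

toBits : ∀ n → ℕ → Vec Bool n
toBits zero    m = []
toBits (suc n) m with 2 ^ n ≤? m
... | yes _ = true  ∷ toBits n (m ∸ 2 ^ n)
... | no  _ = false ∷ toBits n m

binVal<2^n : ∀ {n} (x : Vec Bool n) → binVal x < 2 ^ n
binVal<2^n {zero}  []           = s≤s z≤n
binVal<2^n {suc n} (false ∷ xs) = ≤-trans (binVal<2^n xs) (m≤m+n (2 ^ n) _)
binVal<2^n {suc n} (true  ∷ xs) =
  subst (λ a → a + binVal xs < 2 ^ n + (2 ^ n + 0)) (sym (+-identityʳ (2 ^ n)))
        (+-monoʳ-< (2 ^ n) (≤-trans (binVal<2^n xs) (m≤m+n (2 ^ n) 0)))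

toBits-binVal : ∀ {n} (x : Vec Bool n) → toBits n (binVal x) ≡ x
toBits-binVal {zero}  [] = refl
toBits-binVal {suc n} (true ∷ xs) with 2 ^ n ≤? binVal (true ∷ xs)
... | yes _ = cong (true ∷_) (trans (cong (toBits n) drop-leading) (toBits-binVal xs))
  where
  drop-leading : (2 ^ n + 0) + binVal xs ∸ 2 ^ n ≡ binVal xs
  drop-leading = trans (cong (λ a → a + binVal xs ∸ 2 ^ n) (+-identityʳ (2 ^ n)))
                       (m+n∸m≡n (2 ^ n) (binVal xs))
... | no 2^n≰ = contradiction (≤-trans (m≤m+n (2 ^ n) 0) (m≤m+n _ (binVal xs))) 2^n≰
toBits-binVal {suc n} (false ∷ xs) with 2 ^ n ≤? binVal (false ∷ xs)
... | yes 2^n≤ = contradiction 2^n≤ (<⇒≱ (binVal<2^n xs))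
... | no  _    = cong (false ∷_) (toBits-binVal xs)

mainTheorem8 : ∀ (n : ℕ) → 1 ≤ n → (f : Vec Bool n → Bool) →
    Σ (List PrimeClock) (λ cs → Computes n (⊕Sum cs) f)
mainTheorem8 n _ f with interpolate (2 ^ n) (f ∘ toBits n)
... | cs , agree = cs , λ x → begin
  ⊕Sum cs (binVal x)              ≡⟨ agree (binVal x) (binVal<2^n x) ⟩
  bit (f (toBits n (binVal x)))   ≡⟨ cong (bit ∘ f) (toBits-binVal x) ⟩
  bit (f x)                       ∎
  where open ≡-Reasoning
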